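{- Let $N = p^k m^2$ be an odd perfect number, where $p$ is a prime with $p \equiv k \equiv 1 \pmod 4$, $k$ a positive integer, $m$ a positive integer and $\gcd(p,m)=1$. Then $$\frac{p+1}{p} \le \frac{\sigma(p^k)}{p^k} < \frac{p}{p-1} < \frac{2(p-1)}{p} < \frac{\sigma(m^2)}{m^2} \le \frac{2p}{p+1}.$$
   Context: $\sigma(n)$ denotes the sum of the positive divisors of $n$. An odd perfect number is an odd positive integer $N$ with $\sigma(N)=2N$. -}

module Defs where

open import Data.Nat using (ℕ; zero; suc)
open import Data.Nat.Divisibility using (_∣?_)
open import Data.List using (upTo; map; filter)
open import Data.Nat.ListAction using (sum)
open import Data.Integer using (+_)
open import Data.Rational using (ℚ; _/_; 0ℚ)

σ : ℕ → ℕ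
σ n = sum (filter (_∣? n) (map suc (upTo n)))

-- the rational number a / d; d = 0 is a junk value (never used below,
-- since every denominator in the statement is nonzero under the hypotheses)
frac : ℕ → ℕ → ℚ
frac a zero = 0ℚ
frac a (suc d) = (+ a) / (suc d)

{-# OPTIONS --safe #-}
module Submission where

-- Writing σ n as the sum over d ≤ n of [d ∣ n]·d and splitting the divisors of p·n
-- according to whether p divides them gives σ (p n) = p σ n + σ′ n, where σ′ n sums
-- the divisors of n prime to p; for n = p^k M with p ∤ M, σ′ n = σ M.  Hence
-- σ (p^k M) = σ (p^k) σ M, so the abundancies of p^k and m² multiply to 2.  Since
-- σ (p^k) (p − 1) + 1 = p^(k+1) and σ (p^k) ≥ p^k + p^(k−1), the abundancy of p^k lies
-- in [(p+1)/p, p/(p−1)), which places that of m² in (2(p−1)/p, 2p/(p+1)]; and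
-- p/(p−1) < 2(p−1)/p is p² < 2(p−1)², true for p ≥ 5.

open import Defs
open import Data.Nat using (ℕ; _+_; _*_; _^_; _∸_; _≥_; _%_)
open import Data.Nat.Primality using (Prime)
open import Data.Nat.Coprimality using (Coprime)
open import Data.Product using (_×_)
open import Relation.Binary.PropositionalEquality using (_≡_)

-- The order on ℕ stays local to this module: below, _≤_ and _<_ are the order on ℚ.
module _ where
  open import Data.Nat
  open import Data.Nat.Properties
  open import Data.Nat.Divisibility
  open import Data.Nat.Primality
  open import Data.Nat.Coprimality using (coprime-divisor)
  open import Data.Nat.Tactic.RingSolver using (solve-∀)
  open import Data.Nat.ListAction using (sum)
  open import Data.Nat.ListAction.Properties using (sum-++)
  open import Data.List using (List; []; _∷_; map; filter; upTo; _++_)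
  open import Data.List.Properties using (map-++; upTo-∷ʳ)
  open import Data.Sum using (inj₁; inj₂)
  open import Data.Product using (_,_)
  open import Algebra.Properties.CommutativeSemigroup +-commutativeSemigroup using (interchange)
  open import Relation.Nullary using (Dec; yes; no; ¬_; contradiction)
  open import Relation.Unary using (Decidable)
  open import Relation.Binary.PropositionalEquality

  when : {A : Set} → Dec A → ℕ → ℕ
  when (yes _) x = x
  when (no _)  x = 0

  unless : {A : Set} → Dec A → ℕ → ℕ
  unless (yes _) x = 0
  unless (no _)  x = x

  when+unless : {A : Set} (A? : Dec A) (x : ℕ) → when A? x + unless A? x ≡ x
  when+unless (yes _) x = +-identityʳ x
  when+unless (no _)  x = refl

  sum-filter : {P : ℕ → Set} (P? : Decidable P) (xs : List ℕ) →
               sum (filter P? xs) ≡ sum (map (λ x → when (P? x) x) xs)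
  sum-filter P? []       = refl
  sum-filter P? (x ∷ xs) with P? x
  ... | yes _ = cong (x +_) (sum-filter P? xs)
  ... | no _  = sum-filter P? xs

  sumTo : (ℕ → ℕ) → ℕ → ℕ
  sumTo f zero    = 0
  sumTo f (suc n) = sumTo f n + f (suc n)

  sum-map-suc-upTo : ∀ f n → sum (map f (map suc (upTo n))) ≡ sumTo f n
  sum-map-suc-upTo f zero    = refl
  sum-map-suc-upTo f (suc n) = begin
    sum (map f (map suc (upTo (suc n))))
      ≡⟨ cong (λ xs → sum (map f (map suc xs))) (upTo-∷ʳ n) ⟨
    sum (map f (map suc (upTo n ++ n ∷ [])))
      ≡⟨ cong (λ xs → sum (map f xs)) (map-++ suc (upTo n) (n ∷ [])) ⟩
    sum (map f (map suc (upTo n) ++ suc n ∷ []))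
      ≡⟨ cong sum (map-++ f (map suc (upTo n)) (suc n ∷ [])) ⟩
    sum (map f (map suc (upTo n)) ++ f (suc n) ∷ [])
      ≡⟨ sum-++ (map f (map suc (upTo n))) (f (suc n) ∷ []) ⟩
    sum (map f (map suc (upTo n))) + (f (suc n) + 0)
      ≡⟨ cong₂ _+_ (sum-map-suc-upTo f n) (+-identityʳ (f (suc n))) ⟩
    sumTo f (suc n) ∎
    where open ≡-Reasoning

  sumTo-cong : ∀ {f g} → (∀ d → f d ≡ g d) → ∀ n → sumTo f n ≡ sumTo g n
  sumTo-cong f≗g zero    = refl
  sumTo-cong f≗g (suc n) = cong₂ _+_ (sumTo-cong f≗g n) (f≗g (suc n))

  sumTo-+ : ∀ f g n → sumTo (λ d → f d + g d) n ≡ sumTo f n + sumTo g n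
  sumTo-+ f g zero    = refl
  sumTo-+ f g (suc n) = trans (cong (_+ (f (suc n) + g (suc n))) (sumTo-+ f g n))
                              (interchange (sumTo f n) (sumTo g n) (f (suc n)) (g (suc n)))

  sumTo-* : ∀ c f n → sumTo (λ d → c * f d) n ≡ c * sumTo f n
  sumTo-* c f zero    = sym (*-zeroʳ c)
  sumTo-* c f (suc n) = trans (cong (_+ c * f (suc n)) (sumTo-* c f n))
                              (sym (*-distribˡ-+ c (sumTo f n) (f (suc n))))

  sumTo-partition : {P : ℕ → Set} (P? : Decidable P) (f : ℕ → ℕ) (n : ℕ) →
                    sumTo f n ≡ sumTo (λ d → when (P? d) (f d)) n + sumTo (λ d → unless (P? d) (f d)) n
  sumTo-partition P? f n =
    trans (sumTo-cong (λ d → sym (when+unless (P? d) (f d))) n) (sumTo-+ _ _ n)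

  sumTo-zero : ∀ {f} n → (∀ i → i < n → f (suc i) ≡ 0) → sumTo f n ≡ 0
  sumTo-zero zero    f≡0 = refl
  sumTo-zero (suc n) f≡0 =
    cong₂ _+_ (sumTo-zero n (λ i i<n → f≡0 i (m<n⇒m<1+n i<n))) (f≡0 n ≤-refl)

  sumTo-split : ∀ f m n → sumTo f (m + n) ≡ sumTo f m + sumTo (λ i → f (m + i)) n
  sumTo-split f m zero    = trans (cong (sumTo f) (+-identityʳ m)) (sym (+-identityʳ (sumTo f m)))
  sumTo-split f m (suc n) = begin
    sumTo f (m + suc n)                                       ≡⟨ cong (sumTo f) (+-suc m n) ⟩
    sumTo f (m + n) + f (suc (m + n))                         ≡⟨ cong₂ _+_ (sumTo-split f m n) (cong f (sym (+-suc m n))) ⟩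
    sumTo f m + sumTo (λ i → f (m + i)) n + f (m + suc n)     ≡⟨ +-assoc (sumTo f m) _ _ ⟩
    sumTo f m + sumTo (λ i → f (m + i)) (suc n)               ∎
    where open ≡-Reasoning

  sumTo-extend : ∀ {f n m} → n ≤ m → (∀ d → n < d → f d ≡ 0) → sumTo f m ≡ sumTo f n
  sumTo-extend {f} {n} {m} n≤m f≡0 = begin
    sumTo f m                                        ≡⟨ cong (sumTo f) (m+[n∸m]≡n n≤m) ⟨
    sumTo f (n + (m ∸ n))                            ≡⟨ sumTo-split f n (m ∸ n) ⟩
    sumTo f n + sumTo (λ i → f (n + i)) (m ∸ n)      ≡⟨ cong (sumTo f n +_) (sumTo-zero (m ∸ n) tail≡0) ⟩
    sumTo f n + 0                                    ≡⟨ +-identityʳ (sumTo f n) ⟩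
    sumTo f n                                        ∎
    where
    open ≡-Reasoning
    tail≡0 : ∀ i → i < m ∸ n → f (n + suc i) ≡ 0
    tail≡0 i _ = f≡0 (n + suc i) (m<m+n n z<s)

  sumTo-multiples : ∀ c .{{_ : NonZero c}} (h : ℕ → ℕ) X →
                    sumTo (λ d → when (c ∣? d) (h d)) (c * X) ≡ sumTo (λ j → h (c * j)) X
  sumTo-multiples c       h zero    = cong (sumTo (λ d → when (c ∣? d) (h d))) (*-zeroʳ c)
  sumTo-multiples (suc q) h (suc X) = begin
    sumTo G (c * suc X)                                     ≡⟨ cong (sumTo G) c*[1+X]≡c*X+c ⟩
    sumTo G (c * X + c)                                     ≡⟨ sumTo-split G (c * X) c ⟩
    sumTo G (c * X) + (sumTo (λ i → G (c * X + i)) q + G (c * X + c))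
      ≡⟨ cong (λ x → sumTo G (c * X) + (x + G (c * X + c))) (sumTo-zero q no-multiple) ⟩
    sumTo G (c * X) + G (c * X + c)                         ≡⟨ cong (λ x → sumTo G (c * X) + G x) c*[1+X]≡c*X+c ⟨
    sumTo G (c * X) + G (c * suc X)                         ≡⟨ cong₂ _+_ (sumTo-multiples c h X) (when-yes (m∣m*n (suc X))) ⟩
    sumTo (λ j → h (c * j)) (suc X)                         ∎
    where
    open ≡-Reasoning
    c : ℕ
    c = suc q
    G : ℕ → ℕ
    G d = when (c ∣? d) (h d)
    c*[1+X]≡c*X+c : c * suc X ≡ c * X + c
    c*[1+X]≡c*X+c = trans (*-suc c X) (+-comm c (c * X))
    no-multiple : ∀ i → i < q → G (c * X + suc i) ≡ 0
    no-multiple i i<q with c ∣? (c * X + suc i)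
    ... | yes c∣ = contradiction (∣⇒≤ (∣m+n∣m⇒∣n c∣ (m∣m*n X))) (<⇒≱ (s≤s i<q))
    ... | no _   = refl
    when-yes : ∀ {d} → c ∣ d → G d ≡ h d
    when-yes {d} c∣d with c ∣? d
    ... | yes _  = refl
    ... | no c∤d = contradiction c∣d c∤d

  divisorPart : ℕ → ℕ → ℕ
  divisorPart n d = when (d ∣? n) d

  σ≡sumTo-divisorPart : ∀ n → σ n ≡ sumTo (divisorPart n) n
  σ≡sumTo-divisorPart n =
    trans (sum-filter (_∣? n) (map suc (upTo n))) (sum-map-suc-upTo (divisorPart n) n)

  divisorPart-∤ : ∀ {n d} → ¬ d ∣ n → divisorPart n d ≡ 0
  divisorPart-∤ {n} {d} d∤n with d ∣? n
  ... | yes d∣n = contradiction d∣n d∤n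
  ... | no _    = refl

  divisorPart-> : ∀ {n d} .{{_ : NonZero n}} → n < d → divisorPart n d ≡ 0
  divisorPart-> n<d = divisorPart-∤ (λ d∣n → <⇒≱ n<d (∣⇒≤ d∣n))

  σ-extend : ∀ {n m} .{{_ : NonZero n}} → n ≤ m → σ n ≡ sumTo (divisorPart n) m
  σ-extend {n} n≤m =
    trans (σ≡sumTo-divisorPart n) (sym (sumTo-extend n≤m (λ d → divisorPart->)))

  divisorPart-*-* : ∀ c .{{_ : NonZero c}} n d → divisorPart (c * n) (c * d) ≡ c * divisorPart n d
  divisorPart-*-* c n d with c * d ∣? c * n | d ∣? n
  ... | yes _     | yes _   = refl
  ... | yes cd∣cn | no d∤n  = contradiction (*-cancelˡ-∣ c cd∣cn) d∤n
  ... | no cd∤cn  | yes d∣n = contradiction (*-monoʳ-∣ c d∣n) cd∤cn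
  ... | no _      | no _    = sym (*-zeroʳ c)

  divisorPart-*-cancel : ∀ {c n d} → (d ∣ c * n → d ∣ n) → divisorPart (c * n) d ≡ divisorPart n d
  divisorPart-*-cancel {c} {n} {d} cancel with d ∣? c * n | d ∣? n
  ... | yes _    | yes _   = refl
  ... | yes d∣cn | no d∤n  = contradiction (cancel d∣cn) d∤n
  ... | no d∤cn  | yes d∣n = contradiction (∣n⇒∣m*n c d∣n) d∤cn
  ... | no _     | no _    = refl

  module _ {p : ℕ} (p-prime : Prime p) where
    private instance
      p≢0 : NonZero p
      p≢0 = prime⇒nonZero p-prime

    p≢1 : p ≢ 1
    p≢1 p≡1 = <⇒≢ (nonTrivial⇒n>1 p {{prime⇒nonTrivial p-prime}}) (sym p≡1)

    p∤1 : ¬ p ∣ 1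
    p∤1 p∣1 = p≢1 (∣1⇒≡1 p∣1)

    p∸1+1≡p : p ∸ 1 + 1 ≡ p
    p∸1+1≡p = m∸n+n≡m (>-nonZero⁻¹ p)

    coprime⇒∤ : ∀ {n} → Coprime p n → ¬ p ∣ n
    coprime⇒∤ p⊥n p∣n = p≢1 (p⊥n (∣-refl , p∣n))

    ∤⇒∤^ : ∀ {n} → ¬ p ∣ n → ∀ k → ¬ p ∣ n ^ k
    ∤⇒∤^ p∤n zero    = p∤1
    ∤⇒∤^ {n} p∤n (suc k) p∣n^[1+k] with euclidsLemma n (n ^ k) p-prime p∣n^[1+k]
    ... | inj₁ p∣n   = p∤n p∣n
    ... | inj₂ p∣n^k = ∤⇒∤^ p∤n k p∣n^k

    ∤⇒coprime : ∀ {d} → ¬ p ∣ d → Coprime d p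
    ∤⇒coprime p∤d {c} (c∣d , c∣p) with prime⇒irreducible p-prime c∣p
    ... | inj₁ c≡1 = c≡1
    ... | inj₂ c≡p = contradiction (subst (_∣ _) c≡p c∣d) p∤d

    coprime-∣-^* : ∀ {d n} → Coprime d p → ∀ k → d ∣ p ^ k * n → d ∣ n
    coprime-∣-^* {d} {n} d⊥p zero    d∣1*n = subst (d ∣_) (*-identityˡ n) d∣1*n
    coprime-∣-^* {d} {n} d⊥p (suc k) d∣p*p^k*n =
      coprime-∣-^* d⊥p k (coprime-divisor d⊥p (subst (d ∣_) (*-assoc p (p ^ k) n) d∣p*p^k*n))

    divisorSumPrimeTo : ℕ → ℕ
    divisorSumPrimeTo n = sumTo (λ d → unless (p ∣? d) (divisorPart n d)) n

    σ-* : ∀ n .{{_ : NonZero n}} → σ (p * n) ≡ p * σ n + divisorSumPrimeTo n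
    σ-* n = begin
      σ (p * n)
        ≡⟨ σ≡sumTo-divisorPart (p * n) ⟩
      sumTo (divisorPart (p * n)) (p * n)
        ≡⟨ sumTo-partition (p ∣?_) (divisorPart (p * n)) (p * n) ⟩
      sumTo (λ d → when (p ∣? d) (divisorPart (p * n) d)) (p * n)
        + sumTo (λ d → unless (p ∣? d) (divisorPart (p * n) d)) (p * n)
        ≡⟨ cong₂ _+_ (sumTo-multiples p (divisorPart (p * n)) n) (sumTo-cong prime-to-p (p * n)) ⟩
      sumTo (λ j → divisorPart (p * n) (p * j)) n
        + sumTo (λ d → unless (p ∣? d) (divisorPart n d)) (p * n)
        ≡⟨ cong₂ _+_ (sumTo-cong (divisorPart-*-* p n) n) (sumTo-extend (m≤n*m n p) beyond-n) ⟩
      sumTo (λ j → p * divisorPart n j) n + divisorSumPrimeTo n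
        ≡⟨ cong (_+ divisorSumPrimeTo n) (sumTo-* p (divisorPart n) n) ⟩
      p * sumTo (divisorPart n) n + divisorSumPrimeTo n
        ≡⟨ cong (λ s → p * s + divisorSumPrimeTo n) (σ≡sumTo-divisorPart n) ⟨
      p * σ n + divisorSumPrimeTo n ∎
      where
      open ≡-Reasoning
      prime-to-p : ∀ d → unless (p ∣? d) (divisorPart (p * n) d) ≡ unless (p ∣? d) (divisorPart n d)
      prime-to-p d with p ∣? d
      ... | yes _   = refl
      ... | no p∤d = divisorPart-*-cancel {p} (coprime-divisor (∤⇒coprime p∤d))
      beyond-n : ∀ d → n < d → unless (p ∣? d) (divisorPart n d) ≡ 0
      beyond-n d n<d with p ∣? d
      ... | yes _ = refl
      ... | no _  = divisorPart-> n<d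

    divisorSumPrimeTo-^* : ∀ k n .{{_ : NonZero n}} → ¬ p ∣ n → divisorSumPrimeTo (p ^ k * n) ≡ σ n
    divisorSumPrimeTo-^* k n p∤n = begin
      divisorSumPrimeTo (p ^ k * n)       ≡⟨ sumTo-cong prime-to-p (p ^ k * n) ⟩
      sumTo (divisorPart n) (p ^ k * n)   ≡⟨ σ-extend (m≤n*m n (p ^ k) {{m^n≢0 p k}}) ⟨
      σ n                                 ∎
      where
      open ≡-Reasoning
      prime-to-p : ∀ d → unless (p ∣? d) (divisorPart (p ^ k * n) d) ≡ divisorPart n d
      prime-to-p d with p ∣? d
      ... | yes p∣d = sym (divisorPart-∤ (λ d∣n → p∤n (∣-trans p∣d d∣n)))
      ... | no p∤d  = divisorPart-*-cancel {p ^ k} (coprime-∣-^* (∤⇒coprime p∤d) k)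

    σ-^-suc : ∀ k → σ (p ^ suc k) ≡ p * σ (p ^ k) + 1
    σ-^-suc k = begin
      σ (p * p ^ k)                                      ≡⟨ σ-* (p ^ k) {{m^n≢0 p k}} ⟩
      p * σ (p ^ k) + divisorSumPrimeTo (p ^ k)          ≡⟨ cong (λ n → p * σ (p ^ k) + divisorSumPrimeTo n) (*-identityʳ (p ^ k)) ⟨
      p * σ (p ^ k) + divisorSumPrimeTo (p ^ k * 1)      ≡⟨ cong (p * σ (p ^ k) +_) (divisorSumPrimeTo-^* k 1 p∤1) ⟩
      p * σ (p ^ k) + 1                                  ∎
      where open ≡-Reasoning

    σ-^* : ∀ k n .{{_ : NonZero n}} → ¬ p ∣ n → σ (p ^ k * n) ≡ σ (p ^ k) * σ n
    σ-^* zero    n _   = trans (cong σ (*-identityˡ n)) (sym (*-identityˡ (σ n)))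
    σ-^* (suc k) n p∤n = begin
      σ (p * p ^ k * n)                                     ≡⟨ cong σ (*-assoc p (p ^ k) n) ⟩
      σ (p * (p ^ k * n))                                   ≡⟨ σ-* (p ^ k * n) {{m*n≢0 (p ^ k) n {{m^n≢0 p k}}}} ⟩
      p * σ (p ^ k * n) + divisorSumPrimeTo (p ^ k * n)     ≡⟨ cong₂ (λ x y → p * x + y) (σ-^* k n p∤n) (divisorSumPrimeTo-^* k n p∤n) ⟩
      p * (σ (p ^ k) * σ n) + σ n                           ≡⟨ factor p (σ (p ^ k)) (σ n) ⟩
      (p * σ (p ^ k) + 1) * σ n                             ≡⟨ cong (_* σ n) (σ-^-suc k) ⟨
      σ (p ^ suc k) * σ n                                   ∎
      where
      open ≡-Reasoning
      factor : ∀ a b c → a * (b * c) + c ≡ (a * b + 1) * c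
      factor = solve-∀

    σ-^-geometric : ∀ k → σ (p ^ k) * (p ∸ 1) + 1 ≡ p ^ suc k
    σ-^-geometric zero    =
      trans (cong (_+ 1) (*-identityˡ (p ∸ 1))) (trans p∸1+1≡p (sym (*-identityʳ p)))
    σ-^-geometric (suc k) = begin
      σ (p ^ suc k) * q + 1              ≡⟨ cong (λ s → s * q + 1) (σ-^-suc k) ⟩
      (p * σ (p ^ k) + 1) * q + 1        ≡⟨ expand p (σ (p ^ k)) q ⟩
      p * (σ (p ^ k) * q) + (q + 1)      ≡⟨ cong (p * (σ (p ^ k) * q) +_) p∸1+1≡p ⟩
      p * (σ (p ^ k) * q) + p            ≡⟨ collect p (σ (p ^ k) * q) ⟩
      p * (σ (p ^ k) * q + 1)            ≡⟨ cong (p *_) (σ-^-geometric k) ⟩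
      p * p ^ suc k                      ∎
      where
      open ≡-Reasoning
      q : ℕ
      q = p ∸ 1
      expand : ∀ a b c → (a * b + 1) * c + 1 ≡ a * (b * c) + (c + 1)
      expand = solve-∀
      collect : ∀ a x → a * x + a ≡ a * (x + 1)
      collect = solve-∀

    σ-^-< : ∀ k → σ (p ^ k) * (p ∸ 1) < p ^ suc k
    σ-^-< k = subst (σ (p ^ k) * (p ∸ 1) <_) (σ-^-geometric k) (m<m+n _ z<s)

    σ-^-suc-≥ : ∀ k → p ^ suc k + p ^ k ≤ σ (p ^ suc k)
    σ-^-suc-≥ zero    = ≤-reflexive (sym (σ-^-suc zero))
    σ-^-suc-≥ (suc k) = begin
      p ^ suc (suc k) + p ^ suc k     ≡⟨ *-distribˡ-+ p (p ^ suc k) (p ^ k) ⟨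
      p * (p ^ suc k + p ^ k)         ≤⟨ *-monoʳ-≤ p (σ-^-suc-≥ k) ⟩
      p * σ (p ^ suc k)               ≤⟨ m≤m+n _ 1 ⟩
      p * σ (p ^ suc k) + 1           ≡⟨ σ-^-suc (suc k) ⟨
      σ (p ^ suc (suc k))             ∎
      where open ≤-Reasoning

    σ-^-suc-lower : ∀ k → (p + 1) * p ^ suc k ≤ σ (p ^ suc k) * p
    σ-^-suc-lower k = begin
      (p + 1) * (p * p ^ k)     ≡⟨ rearrange p (p ^ k) ⟩
      (p * p ^ k + p ^ k) * p   ≤⟨ *-monoˡ-≤ p (σ-^-suc-≥ k) ⟩
      σ (p ^ suc k) * p         ∎
      where
      open ≤-Reasoning
      rearrange : ∀ a b → (a + 1) * (a * b) ≡ (a * b + b) * a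
      rearrange = solve-∀

  -- Read as fractions: if (S/P)·(s/M) = c, then S/P < b/a gives c·a/b < s/M.
  complementary-ratio-< : ∀ S s P M c a b .{{_ : NonZero c}} .{{_ : NonZero P}} .{{_ : NonZero M}} →
                          S * s ≡ c * (P * M) → S * a < b * P → c * a * M < s * b
  complementary-ratio-< S s P M c a b Ss≡cPM Sa<bP = *-cancelˡ-< P _ _ (begin-strict
    P * (c * a * M)   ≡⟨ swap₁ P c a M ⟩
    c * (P * M) * a   ≡⟨ cong (_* a) Ss≡cPM ⟨
    S * s * a         ≡⟨ swap₂ S s a ⟩
    s * (S * a)       <⟨ *-monoʳ-< s {{s≢0}} Sa<bP ⟩
    s * (b * P)       ≡⟨ swap₃ s b P ⟩
    P * (s * b)       ∎)
    where
    open ≤-Reasoning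
    instance
      P*M≢0 : NonZero (P * M)
      P*M≢0 = m*n≢0 P M
    s≢0 : NonZero s
    s≢0 = ≢-nonZero λ s≡0 → ≢-nonZero⁻¹ (c * (P * M)) {{m*n≢0 c (P * M)}}
            (trans (sym Ss≡cPM) (trans (cong (S *_) s≡0) (*-zeroʳ S)))
    swap₁ : ∀ x y z w → x * (y * z * w) ≡ y * (x * w) * z
    swap₁ = solve-∀
    swap₂ : ∀ x y z → x * y * z ≡ y * (x * z)
    swap₂ = solve-∀
    swap₃ : ∀ x y z → x * (y * z) ≡ z * (x * y)
    swap₃ = solve-∀

  complementary-ratio-≤ : ∀ S s P M c a b .{{_ : NonZero P}} →
                          S * s ≡ c * (P * M) → a * P ≤ S * b → s * a ≤ c * b * M
  complementary-ratio-≤ S s P M c a b Ss≡cPM aP≤Sb = *-cancelˡ-≤ P (begin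
    P * (s * a)       ≡⟨ swap₁ P s a ⟩
    s * (a * P)       ≤⟨ *-monoʳ-≤ s aP≤Sb ⟩
    s * (S * b)       ≡⟨ swap₂ s S b ⟩
    S * s * b         ≡⟨ cong (_* b) Ss≡cPM ⟩
    c * (P * M) * b   ≡⟨ swap₃ c P M b ⟩
    P * (c * b * M)   ∎)
    where
    open ≤-Reasoning
    swap₁ : ∀ x y z → x * (y * z) ≡ y * (z * x)
    swap₁ = solve-∀
    swap₂ : ∀ x y z → x * (y * z) ≡ y * x * z
    swap₂ = solve-∀
    swap₃ : ∀ x y z w → x * (y * z) * w ≡ y * (x * w * z)
    swap₃ = solve-∀

  prime≡1mod4⇒5≤ : ∀ {p} → Prime p → p % 4 ≡ 1 → 5 ≤ p
  prime≡1mod4⇒5≤ {1} () _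
  prime≡1mod4⇒5≤ {suc (suc (suc (suc (suc _))))} _ _ = s≤s (s≤s (s≤s (s≤s (s≤s z≤n))))

  square<2*pred-square : ∀ {p} → 4 ≤ p → p * p < 2 * (p ∸ 1) * (p ∸ 1)
  square<2*pred-square {suc (suc (suc (suc r)))} (s≤s (s≤s (s≤s (s≤s _)))) = begin-strict
    (4 + r) * (4 + r)                           <⟨ m<m+n _ z<s ⟩
    (4 + r) * (4 + r) + (2 + 4 * r + r * r)     ≡⟨ difference r ⟩
    2 * (3 + r) * (3 + r)                       ∎
    where
    open ≤-Reasoning
    difference : ∀ x → (4 + x) * (4 + x) + (2 + 4 * x + x * x) ≡ 2 * (3 + x) * (3 + x)
    difference = solve-∀

open import Data.Nat as ℕ using (NonZero; suc; s≤s; z≤n)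
open import Data.Nat.Properties using (m^n≢0; m≤n+m; m<n⇒0<n∸m; <⇒≤)
open import Data.Nat.Primality using (prime⇒nonZero; prime⇒nonTrivial)
open import Data.Integer as ℤ using (+_; +≤+; +<+)
open import Data.Integer.Properties using (pos-*)
open import Data.Rational using (_≤_; _<_; toℚᵘ)
open import Data.Rational.Properties using (toℚᵘ-cancel-≤; toℚᵘ-cancel-<; toℚᵘ-fromℚᵘ)
open import Data.Rational.Unnormalised using (mkℚᵘ; *≤*; *<*; _≃_)
open import Data.Rational.Unnormalised.Properties using (≃-sym; ≤-respˡ-≃; ≤-respʳ-≃; <-respˡ-≃; <-respʳ-≃)
open import Data.Product using (_,_)
open import Relation.Binary.PropositionalEquality using (refl; sym; trans; subst₂)

toℚᵘ-frac : ∀ a b → toℚᵘ (frac a (suc b)) ≃ mkℚᵘ (+ a) b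
toℚᵘ-frac a b = toℚᵘ-fromℚᵘ (mkℚᵘ (+ a) b)

frac-≤ : ∀ {a b c d} .{{_ : NonZero b}} .{{_ : NonZero d}} → a * d ℕ.≤ c * b → frac a b ≤ frac c d
frac-≤ {a} {suc b} {c} {suc d} ad≤cb =
  toℚᵘ-cancel-≤ (≤-respʳ-≃ (≃-sym (toℚᵘ-frac c d)) (≤-respˡ-≃ (≃-sym (toℚᵘ-frac a b))
    (*≤* (subst₂ ℤ._≤_ (pos-* a (suc d)) (pos-* c (suc b)) (+≤+ ad≤cb)))))

frac-< : ∀ {a b c d} .{{_ : NonZero b}} .{{_ : NonZero d}} → a * d ℕ.< c * b → frac a b < frac c d
frac-< {a} {suc b} {c} {suc d} ad<cb =
  toℚᵘ-cancel-< (<-respʳ-≃ (≃-sym (toℚᵘ-frac c d)) (<-respˡ-≃ (≃-sym (toℚᵘ-frac a b))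
    (*<* (subst₂ ℤ._<_ (pos-* a (suc d)) (pos-* c (suc b)) (+<+ ad<cb)))))

corollary4p2p1 : (N p k m : ℕ) → N % 2 ≡ 1 → σ N ≡ 2 * N →
    N ≡ p ^ k * m ^ 2 → Prime p → p % 4 ≡ 1 → k % 4 ≡ 1 → k ≥ 1 → m ≥ 1 →
    Coprime p m →
    (frac (p + 1) p ≤ frac (σ (p ^ k)) (p ^ k))
    × (frac (σ (p ^ k)) (p ^ k) < frac p (p ∸ 1))
    × (frac p (p ∸ 1) < frac (2 * (p ∸ 1)) p)
    × (frac (2 * (p ∸ 1)) p < frac (σ (m ^ 2)) (m ^ 2))
    × (frac (σ (m ^ 2)) (m ^ 2) ≤ frac (2 * p) (p + 1))
corollary4p2p1 _ p _ m _ σN≡2N refl p-prime p≡1mod4 _ (s≤s {n = k} z≤n) m≥1 p⊥m =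
  frac-≤ (σ-^-suc-lower p-prime k) ,
  frac-< (σ-^-< p-prime (suc k)) ,
  frac-< (square<2*pred-square (<⇒≤ (prime≡1mod4⇒5≤ p-prime p≡1mod4))) ,
  frac-< (complementary-ratio-< (σ P) (σ M) P M 2 (p ∸ 1) p σP*σM≡2PM (σ-^-< p-prime (suc k))) ,
  frac-≤ (complementary-ratio-≤ (σ P) (σ M) P M 2 (p + 1) p σP*σM≡2PM (σ-^-suc-lower p-prime k))
  where
  P M : ℕ
  P = p ^ suc k
  M = m ^ 2
  instance
    p≢0 : NonZero p
    p≢0 = prime⇒nonZero p-prime
    p∸1≢0 : NonZero (p ∸ 1)
    p∸1≢0 = ℕ.>-nonZero (m<n⇒0<n∸m (ℕ.nonTrivial⇒n>1 p {{prime⇒nonTrivial p-prime}}))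
    p+1≢0 : NonZero (p + 1)
    p+1≢0 = ℕ.>-nonZero (m≤n+m 1 p)
    m≢0 : NonZero m
    m≢0 = ℕ.>-nonZero m≥1
    P≢0 : NonZero P
    P≢0 = m^n≢0 p (suc k)
    M≢0 : NonZero M
    M≢0 = m^n≢0 m 2
  σP*σM≡2PM : σ P * σ M ≡ 2 * (P * M)
  σP*σM≡2PM = trans (sym (σ-^* p-prime (suc k) M (∤⇒∤^ p-prime (coprime⇒∤ p-prime p⊥m) 2))) σN≡2N
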